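{- For every heavy graph parameter $\rho$ and every integer $c$, the $(\rho,c)$-modulator number $\mu_{\rho,c}$ (with its canonical hyperparameterisation) is awesome; that is, a graph class has clique-bounded $\mu_{\rho,c}$ if and only if it has bounded $\alpha\text{ - }\mu_{\rho,c}$.
   Context: All graphs are finite, simple and undirected; $\alpha,\omega$ denote independence and clique number. A graph class is a set of graphs closed under isomorphism. A graph parameter is heavy if it is monotone under induced subgraphs (its value on an induced subgraph of $G$ is at most its value on $G$) and unbounded on the class of complete graphs. For a graph parameter $\rho$ and integer $c$, a set $S\subseteq V(G)$ is a $(\rho,c)$-modulator of $G$ if $\rho(G-S)\le c$; $\mu_{\rho,c}(G)$ is the minimum $|S|$ over all $(\rho,c)$-modulators $S$ of $G$, and its independence variant $\alpha\text{ - }\mu_{\rho,c}(G)$ is the minimum of $\alpha(G[S])$ over all $(\rho,c)$-modulators $S$ of $G$. For a graph parameter $\sigma$, a class $\mathcal G$ has bounded $\sigma$ if there is an integer $k$ with $\sigma(G')\le k$ for every induced subgraph $G'$ of every $G\in\mathcal G$; it has clique-bounded $\sigma$ if there is a nondecreasing $f$ with $\sigma(G')\le f(\omega(G'))$ for all such $G'$. -}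

module Defs where

open import Data.Nat as ℕ using (ℕ; zero; suc; _⊔_; _<_)
open import Data.Integer as ℤ using (ℤ; +_)
open import Data.Bool using (Bool; true; false; not; _∧_; _∨_; T)
open import Data.Fin using (Fin; _≟_)
open import Data.Fin.Subset using (Subset; ∣_∣; ∁)
open import Data.List using (List; []; _∷_; [_]; map; _++_; length; lookup; filterᵇ; allFin; foldr)
open import Data.Vec as Vec using ([]; _∷_)
open import Data.Product using (Σ; _×_; _,_; ∃; ∃-syntax; Σ-syntax)
open import Function using (_⇔_)
open import Function.Definitions using (Injective)
open import Relation.Nullary.Decidable using (⌊_⌋)
open import Relation.Binary.PropositionalEquality using (_≡_)

record Graph : Set where
  field
    n      : ℕ
    adj    : Fin n → Fin n → Bool
    sym    : ∀ i j → adj i j ≡ adj j i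
    irrefl : ∀ i → adj i i ≡ false
open Graph public

Iso : Graph → Graph → Set
Iso G H = Σ (Fin (n G) → Fin (n H)) λ f → Σ (Fin (n H) → Fin (n G)) λ g →
  (∀ x → g (f x) ≡ x) × (∀ y → f (g y) ≡ y) ×
  (∀ i j → adj H (f i) (f j) ≡ adj G i j)

_≤ᵢ_ : Graph → Graph → Set
H ≤ᵢ G = Σ (Fin (n H) → Fin (n G)) λ e →
  Injective _≡_ _≡_ e × (∀ i j → adj G (e i) (e j) ≡ adj H i j)

-- Graph induced on a list of vertices (used with duplicate-free lists)
induce : (G : Graph) → List (Fin (n G)) → Graph
induce G l = record
  { n = length l
  ; adj = λ i j → adj G (lookup l i) (lookup l j)
  ; sym = λ i j → sym G (lookup l i) (lookup l j)
  ; irrefl = λ i → irrefl G (lookup l i)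
  }

members : ∀ {m} → Subset m → List (Fin m)
members {m} S = filterᵇ (λ i → Vec.lookup S i) (allFin m)

_⟦_⟧ : (G : Graph) → Subset (n G) → Graph
G ⟦ S ⟧ = induce G (members S)

_─_ : (G : Graph) → Subset (n G) → Graph
G ─ S = induce G (members (∁ S))

K : ℕ → Graph
K m = record
  { n = m
  ; adj = λ i j → not ⌊ i ≟ j ⌋
  ; sym = symK
  ; irrefl = irrK
  }
  where
  open import Relation.Binary.PropositionalEquality using (refl) renaming (sym to ≡sym)
  open import Relation.Nullary using (yes; no)
  symK : ∀ (i j : Fin m) → not ⌊ i ≟ j ⌋ ≡ not ⌊ j ≟ i ⌋
  symK i j with i ≟ j | j ≟ i
  ... | yes _ | yes _ = refl
  ... | no _  | no _  = refl
  ... | yes p | no q  = Data.Empty.⊥-elim (q (≡sym p))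
    where import Data.Empty
  ... | no p  | yes q = Data.Empty.⊥-elim (p (≡sym q))
    where import Data.Empty
  irrK : ∀ (i : Fin m) → not ⌊ i ≟ i ⌋ ≡ false
  irrK i with i ≟ i
  ... | yes _ = refl
  ... | no p = Data.Empty.⊥-elim (p refl)
    where import Data.Empty

subsets : (m : ℕ) → List (Subset m)
subsets zero    = [ [] ]
subsets (suc m) = map (true ∷_) (subsets m) ++ map (false ∷_) (subsets m)

allᵇ : {A : Set} → (A → Bool) → List A → Bool
allᵇ p = foldr (λ x b → p x ∧ b) true

maxℕ : List ℕ → ℕ
maxℕ = foldr _⊔_ 0

isCliqueᵇ : (G : Graph) → Subset (n G) → Bool
isCliqueᵇ G S = allᵇ (λ i → allᵇ (λ j →
    not (Vec.lookup S i ∧ Vec.lookup S j) ∨ ⌊ i ≟ j ⌋ ∨ adj G i j)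
  (allFin (n G))) (allFin (n G))

isIndepᵇ : (G : Graph) → Subset (n G) → Bool
isIndepᵇ G S = allᵇ (λ i → allᵇ (λ j →
    not (Vec.lookup S i ∧ Vec.lookup S j) ∨ ⌊ i ≟ j ⌋ ∨ not (adj G i j))
  (allFin (n G))) (allFin (n G))

ω : Graph → ℕ
ω G = maxℕ (map ∣_∣ (filterᵇ (isCliqueᵇ G) (subsets (n G))))

α : Graph → ℕ
α G = maxℕ (map ∣_∣ (filterᵇ (isIndepᵇ G) (subsets (n G))))

GraphParameter : Set
GraphParameter = Graph → ℕ

Heavy : GraphParameter → Set
Heavy ρ = (∀ H G → H ≤ᵢ G → ρ H ℕ.≤ ρ G)
        × (∀ k → ∃[ m ] k < ρ (K m))

Modulator : GraphParameter → ℤ → (G : Graph) → Subset (n G) → Set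
Modulator ρ c G S = + ρ (G ─ S) ℤ.≤ c

-- Since μ may be undefined (= ∞) when no modulator exists, parameters
-- built from minima are represented by their "value ≤ k" relation:
-- ParamLe σ G k  means  σ(G) ≤ k.
ParamLe : Set₁
ParamLe = Graph → ℕ → Set

μ≤ : GraphParameter → ℤ → ParamLe
μ≤ ρ c G k = ∃[ S ] Modulator ρ c G S × ∣ S ∣ ℕ.≤ k

αμ≤ : GraphParameter → ℤ → ParamLe
αμ≤ ρ c G k = ∃[ S ] Modulator ρ c G S × α (G ⟦ S ⟧) ℕ.≤ k

GraphClass : Set₁
GraphClass = Σ (Graph → Set) λ 𝒢 → ∀ G H → Iso G H → 𝒢 G → 𝒢 H

_∋_ : GraphClass → Graph → Set
(𝒢 , _) ∋ G = 𝒢 G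

Bounded : ParamLe → GraphClass → Set
Bounded σ≤ 𝒢 = ∃[ k ] (∀ G → 𝒢 ∋ G → ∀ G′ → G′ ≤ᵢ G → σ≤ G′ k)

CliqueBounded : ParamLe → GraphClass → Set
CliqueBounded σ≤ 𝒢 = Σ[ f ∈ (ℕ → ℕ) ] ((∀ a b → a ℕ.≤ b → f a ℕ.≤ f b)
  × (∀ G → 𝒢 ∋ G → ∀ G′ → G′ ≤ᵢ G → σ≤ G′ (f (ω G′))))

-- Forward: take a (ρ,c)-modulator S of least size.  If G[S] had an independent set I
-- of size f(m₀) + 1, where c < ρ(K m₀), then every clique of G − (S ∖ I) meets I at most
-- once and otherwise lies in G − S, which has no K m₀; so ω(G − (S ∖ I)) ≤ m₀, and a
-- modulator of G − (S ∖ I) of size at most f(m₀) together with S ∖ I is a smaller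
-- modulator of G.  Backward: by Ramsey's theorem a graph H has fewer than
-- 2^(ω H + α H + 2) vertices, so a modulator S with α(G[S]) ≤ k has size below
-- 2^(ω G + k + 2).
module Submission where

open import Defs
open import Data.Bool using (Bool; true; false; not; T; _∧_; _∨_)
open import Data.Bool.Properties using (T-≡; T-∧; not-¬)
open import Data.Empty using (⊥-elim)
open import Data.Fin as Fin using (Fin; zero; suc; punchIn; inject≤)
open import Data.Fin.Properties
  using (any?; injective⇒≤; inject≤-injective; punchIn-injective; punchInᵢ≢i)
open import Data.Fin.Subset
  using (Subset; inside; outside; _∈_; _∉_; _⊆_; ∁; _∪_; ⊤; ∣_∣)
  renaming (_─_ to _∖_)
open import Data.Fin.Subset.Properties
  using (_∈?_; ∈⊤; drop-∷-⊆; x∈p∪q⁺; x∈p∧x∉q⇒x∈p─q; x∉p⇒x∈∁p; x∈∁p⇒x∉p)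
open import Data.Integer as ℤ using (ℤ; +_)
import Data.Integer.Properties as ℤ
open import Data.List as List using (List; []; _∷_; length; filterᵇ; allFin)
open import Data.List.Membership.Propositional using () renaming (_∈_ to _∈ₗ_)
open import Data.List.Membership.Propositional.Properties
  using (∈-lookup; ∈-filter⁺; ∈-filter⁻; ∈-allFin; ∈-map⁺; ∈-map⁻; ∈-++⁺ˡ; ∈-++⁺ʳ)
open import Data.List.Relation.Unary.All as All using ()
open import Data.List.Relation.Unary.Any using (here; there; index)
open import Data.List.Relation.Unary.Any.Properties using (lookup-index)
open import Data.List.Relation.Unary.AllPairs using (_∷_)
open import Data.List.Relation.Unary.Unique.Propositional using (Unique)
import Data.List.Relation.Unary.Unique.Propositional.Properties as Unique
open import Data.Nat using (ℕ; zero; suc; _+_; _^_; _≤_; _<_; z≤n; s≤s)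
open import Data.Nat.Induction using (<-wellFounded)
open import Data.Nat.Properties
open import Data.Product using (Σ-syntax; ∃-syntax; _×_; _,_; proj₁; proj₂)
open import Data.Sum as Sum using (_⊎_; inj₁; inj₂; [_,_]′)
open import Data.Vec as Vec using (_∷_)
open import Data.Vec.Properties using (lookup⇒[]=; []=⇒lookup; lookup∘tabulate)
open import Function using (_∘_; id; _⇔_; mk⇔; Equivalence)
open import Function.Definitions using (Injective)
open import Induction.WellFounded using (Acc; acc)
open import Level using (0ℓ)
open import Relation.Binary.PropositionalEquality as ≡ using (_≡_; _≢_; refl; cong; cong₂; subst)
open import Relation.Nullary using (¬_; Dec; yes; no)
open import Relation.Nullary.Decidable using (⌊_⌋; _×-dec_; T?; toWitness; fromWitness)
open import Relation.Unary using (Pred; Decidable)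

Unique⇒lookup-injective : ∀ {A : Set} {xs : List A} → Unique xs → Injective _≡_ _≡_ (List.lookup xs)
Unique⇒lookup-injective (_ ∷ _) {zero} {zero} _ = refl
Unique⇒lookup-injective {xs = _ ∷ xs} (x∉xs ∷ _) {zero} {suc j} eq =
  ⊥-elim (All.lookup x∉xs (∈-lookup {xs = xs} j) eq)
Unique⇒lookup-injective {xs = _ ∷ xs} (x∉xs ∷ _) {suc i} {zero} eq =
  ⊥-elim (All.lookup x∉xs (∈-lookup {xs = xs} i) (≡.sym eq))
Unique⇒lookup-injective (_ ∷ xs-unique) {suc i} {suc j} eq =
  cong suc (Unique⇒lookup-injective xs-unique eq)

≤maxℕ : ∀ {x} {xs : List ℕ} → x ∈ₗ xs → x ≤ maxℕ xs
≤maxℕ {xs = x ∷ xs} (here refl) = m≤m⊔n x (maxℕ xs)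
≤maxℕ {xs = y ∷ xs} (there x∈xs) = ≤-trans (≤maxℕ x∈xs) (m≤n⊔m y (maxℕ xs))

<maxℕ⇒ : ∀ {k} (xs : List ℕ) → k < maxℕ xs → ∃[ x ] x ∈ₗ xs × k < x
<maxℕ⇒ {k} (x ∷ xs) k<max with ≤-total x (maxℕ xs)
... | inj₁ x≤max with <maxℕ⇒ xs (subst (k <_) (m≤n⇒m⊔n≡n x≤max) k<max)
...   | y , y∈xs , k<y = y , there y∈xs , k<y
<maxℕ⇒ {k} (x ∷ xs) k<max | inj₂ max≤x = x , here refl , subst (k <_) (m≥n⇒m⊔n≡m max≤x) k<max

pigeonhole-+ : ∀ a p q → a + a ≤ suc (p + q) → a ≤ p ⊎ a ≤ q
pigeonhole-+ a p q a+a≤ with a ≤? p | a ≤? q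
... | yes a≤p | _       = inj₁ a≤p
... | no _    | yes a≤q = inj₂ a≤q
... | no a≰p  | no a≰q  = ⊥-elim (1+n≰n (≤-trans two-more a+a≤))
  where
  two-more : suc (suc (p + q)) ≤ a + a
  two-more = subst (_≤ a + a) (cong suc (+-suc p q)) (+-mono-≤ (≰⇒> a≰p) (≰⇒> a≰q))

unique⇒punchIn-avoids : ∀ {m} {P : Pred (Fin (suc m)) 0ℓ} → Decidable P →
  (∀ {i j} → P i → P j → i ≡ j) → ∃[ i₀ ] ∀ j → ¬ P (punchIn i₀ j)
unique⇒punchIn-avoids P? unique with any? P?
... | yes (i₀ , Pi₀) = i₀ , λ j Pj → punchInᵢ≢i i₀ j (unique Pj Pi₀)
... | no ¬∃P         = zero , λ j Pj → ¬∃P (_ , Pj)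

descend : ∀ {A : Set} (size : A → ℕ) {M Q : A → Set} → (∀ x → Dec (Q x)) →
  (∀ {x} → M x → ¬ Q x → ∃[ y ] M y × size y < size x) → ∀ {x} → M x → ∃[ y ] M y × Q y
descend size {M} {Q} Q? shrink {x} Mx = go x Mx (<-wellFounded (size x))
  where
  go : ∀ x → M x → Acc _<_ (size x) → ∃[ y ] M y × Q y
  go x Mx (acc smaller) with Q? x
  ... | yes Qx = x , Mx , Qx
  ... | no ¬Qx with shrink Mx ¬Qx
  ...   | y , My , y<x = go y My (smaller y<x)

+≤⇒≤∣∣ : ∀ {a c} → + a ℤ.≤ c → a ≤ ℤ.∣ c ∣
+≤⇒≤∣∣ (ℤ.+≤+ a≤b) = a≤b

T-lookup⇒∈ : ∀ {m} {S : Subset m} {v} → T (Vec.lookup S v) → v ∈ S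
T-lookup⇒∈ {S = S} {v} t = lookup⇒[]= v S (Equivalence.to T-≡ t)

∈⇒T-lookup : ∀ {m} {S : Subset m} {v} → v ∈ S → T (Vec.lookup S v)
∈⇒T-lookup v∈S = Equivalence.from T-≡ ([]=⇒lookup v∈S)

decSubset : ∀ {m} {Q : Pred (Fin m) 0ℓ} → Decidable Q → Subset m
decSubset Q? = Vec.tabulate (⌊_⌋ ∘ Q?)

module _ {m} {Q : Pred (Fin m) 0ℓ} (Q? : Decidable Q) where

  ∈-decSubset⁺ : ∀ {v} → Q v → v ∈ decSubset Q?
  ∈-decSubset⁺ {v} q =
    T-lookup⇒∈ (subst T (≡.sym (lookup∘tabulate (⌊_⌋ ∘ Q?) v)) (fromWitness {a? = Q? v} q))

  ∈-decSubset⁻ : ∀ {v} → v ∈ decSubset Q? → Q v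
  ∈-decSubset⁻ {v} v∈ =
    toWitness {a? = Q? v} (subst T (lookup∘tabulate (⌊_⌋ ∘ Q?) v) (∈⇒T-lookup v∈))

image : ∀ {k m} → (Fin k → Fin m) → Subset k → Subset m
image φ P = decSubset λ v → any? λ i → i ∈? P ×-dec φ i Fin.≟ v

module _ {k m} (φ : Fin k → Fin m) {P : Subset k} where

  ∈-image⁺ : ∀ {i} → i ∈ P → φ i ∈ image φ P
  ∈-image⁺ {i} i∈P = ∈-decSubset⁺ _ (i , i∈P , refl)

  ∈-image⁻ : ∀ {v} → v ∈ image φ P → ∃[ i ] i ∈ P × φ i ≡ v
  ∈-image⁻ = ∈-decSubset⁻ _

∣p∪q∣≤∣p∣+∣q∣ : ∀ {m} (p q : Subset m) → ∣ p ∪ q ∣ ≤ ∣ p ∣ + ∣ q ∣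
∣p∪q∣≤∣p∣+∣q∣ Vec.[] Vec.[] = z≤n
∣p∪q∣≤∣p∣+∣q∣ (outside ∷ p) (outside ∷ q) = ∣p∪q∣≤∣p∣+∣q∣ p q
∣p∪q∣≤∣p∣+∣q∣ (inside ∷ p) (outside ∷ q) = s≤s (∣p∪q∣≤∣p∣+∣q∣ p q)
∣p∪q∣≤∣p∣+∣q∣ (outside ∷ p) (inside ∷ q) =
  subst (suc ∣ p ∪ q ∣ ≤_) (≡.sym (+-suc ∣ p ∣ ∣ q ∣)) (s≤s (∣p∪q∣≤∣p∣+∣q∣ p q))
∣p∪q∣≤∣p∣+∣q∣ (inside ∷ p) (inside ∷ q) =
  s≤s (≤-trans (∣p∪q∣≤∣p∣+∣q∣ p q) (subst (∣ p ∣ + ∣ q ∣ ≤_) (≡.sym (+-suc ∣ p ∣ ∣ q ∣)) (n≤1+n _)))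

∣p∖q∣+∣q∣≡∣p∣ : ∀ {m} {p q : Subset m} → q ⊆ p → ∣ p ∖ q ∣ + ∣ q ∣ ≡ ∣ p ∣
∣p∖q∣+∣q∣≡∣p∣ {p = Vec.[]} {Vec.[]} _ = refl
∣p∖q∣+∣q∣≡∣p∣ {p = outside ∷ p} {outside ∷ q} q⊆p = ∣p∖q∣+∣q∣≡∣p∣ (drop-∷-⊆ q⊆p)
∣p∖q∣+∣q∣≡∣p∣ {p = inside ∷ p} {outside ∷ q} q⊆p = cong suc (∣p∖q∣+∣q∣≡∣p∣ (drop-∷-⊆ q⊆p))
∣p∖q∣+∣q∣≡∣p∣ {p = inside ∷ p} {inside ∷ q} q⊆p =
  ≡.trans (+-suc ∣ p ∖ q ∣ ∣ q ∣) (cong suc (∣p∖q∣+∣q∣≡∣p∣ (drop-∷-⊆ q⊆p)))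
∣p∖q∣+∣q∣≡∣p∣ {p = outside ∷ p} {inside ∷ q} q⊆p with q⊆p Vec.here
... | ()

ι : ∀ {m} (S : Subset m) → Fin (length (members S)) → Fin m
ι S = List.lookup (members S)

module _ {m} (S : Subset m) where

  ι-∈ : ∀ x → ι S x ∈ S
  ι-∈ x = T-lookup⇒∈ (proj₂ (∈-filter⁻ (T? ∘ Vec.lookup S) {xs = allFin m} (∈-lookup x)))

  ι-injective : Injective _≡_ _≡_ (ι S)
  ι-injective = Unique⇒lookup-injective (Unique.filter⁺ (T? ∘ Vec.lookup S) (Unique.allFin⁺ m))

  ι-surjective : ∀ {v} → v ∈ S → ∃[ x ] ι S x ≡ v
  ι-surjective {v} v∈S = index v∈members , ≡.sym (lookup-index v∈members)
    where
    v∈members : v ∈ₗ members S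
    v∈members = ∈-filter⁺ (T? ∘ Vec.lookup S) (∈-allFin v) (∈⇒T-lookup v∈S)

length-filterᵇ-tabulate : ∀ {A : Set} {m} (p : A → Bool) (f : Fin m → A) (S : Subset m) →
  (∀ i → p (f i) ≡ Vec.lookup S i) → length (filterᵇ p (List.tabulate f)) ≡ ∣ S ∣
length-filterᵇ-tabulate p f Vec.[] _ = refl
length-filterᵇ-tabulate p f (_ ∷ S) pf≗S with p (f zero) | pf≗S zero
... | true  | refl = cong suc (length-filterᵇ-tabulate p (f ∘ suc) S (pf≗S ∘ suc))
... | false | refl = length-filterᵇ-tabulate p (f ∘ suc) S (pf≗S ∘ suc)

length-members : ∀ {m} (S : Subset m) → length (members S) ≡ ∣ S ∣
length-members S = length-filterᵇ-tabulate (Vec.lookup S) id S (λ _ → refl)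

factor-injective : ∀ {A B C : Set} {φ : A → C} {ψ : A → B} (h : B → C) →
  (∀ a → h (ψ a) ≡ φ a) → Injective _≡_ _≡_ φ → Injective _≡_ _≡_ ψ
factor-injective {φ = φ} {ψ} h hψ≗φ φ-injective {a} {b} ψa≡ψb =
  φ-injective (≡.trans (≡.sym (hψ≗φ a)) (≡.trans (cong h ψa≡ψb) (hψ≗φ b)))

factor-ι : ∀ {a m} (S : Subset m) (φ : Fin a → Fin m) → (∀ i → φ i ∈ S) →
  Σ[ ψ ∈ (Fin a → Fin (length (members S))) ] (∀ i → ι S (ψ i) ≡ φ i)
factor-ι S φ φ∈S = (λ i → proj₁ (ι-surjective S (φ∈S i))) , (λ i → proj₂ (ι-surjective S (φ∈S i)))

injective⇒≤∣∣ : ∀ {a m} {P : Subset m} (φ : Fin a → Fin m) →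
  Injective _≡_ _≡_ φ → (∀ i → φ i ∈ P) → a ≤ ∣ P ∣
injective⇒≤∣∣ {P = P} φ φ-injective φ∈P with factor-ι P φ φ∈P
... | ψ , ιψ≗φ =
  subst (_ ≤_) (length-members P) (injective⇒≤ (factor-injective (ι P) ιψ≗φ φ-injective))

∣image∣≤∣∣ : ∀ {k m} (φ : Fin k → Fin m) (P : Subset k) → ∣ image φ P ∣ ≤ ∣ P ∣
∣image∣≤∣∣ φ P = subst (_≤ ∣ P ∣) (length-members (image φ P)) (injective⇒≤∣∣ ψ ψ-injective ψ∈P)
  where
  preimage : ∀ x → ∃[ i ] i ∈ P × φ i ≡ ι (image φ P) x
  preimage x = ∈-image⁻ φ (ι-∈ (image φ P) x)
  ψ : Fin (length (members (image φ P))) → Fin _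
  ψ = proj₁ ∘ preimage
  ψ∈P : ∀ x → ψ x ∈ P
  ψ∈P = proj₁ ∘ proj₂ ∘ preimage
  ψ-injective : Injective _≡_ _≡_ ψ
  ψ-injective = factor-injective φ (proj₂ ∘ proj₂ ∘ preimage) (ι-injective (image φ P))

⟦⟧-≤ᵢ : (G : Graph) (S : Subset (n G)) → (G ⟦ S ⟧) ≤ᵢ G
⟦⟧-≤ᵢ G S = ι S , ι-injective S , λ _ _ → refl

≤ᵢ-refl : ∀ {G} → G ≤ᵢ G
≤ᵢ-refl = id , id , λ _ _ → refl

≤ᵢ-trans : ∀ {F G H} → F ≤ᵢ G → G ≤ᵢ H → F ≤ᵢ H
≤ᵢ-trans (e , e-inj , e-adj) (f , f-inj , f-adj) =
  f ∘ e , e-inj ∘ f-inj , λ i j → ≡.trans (f-adj (e i) (e j)) (e-adj i j)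

≤ᵢ-restrict : ∀ {H G} (e : H ≤ᵢ G) (S : Subset (n G)) → (∀ i → proj₁ e i ∈ S) →
  Σ[ e′ ∈ H ≤ᵢ (G ⟦ S ⟧) ] (∀ i → ι S (proj₁ e′ i) ≡ proj₁ e i)
≤ᵢ-restrict {G = G} (e , e-inj , e-adj) S e∈S with factor-ι S e e∈S
... | ψ , ιψ≗e =
  ( ψ
  , factor-injective (ι S) ιψ≗e e-inj
  , λ i j → ≡.trans (cong₂ (adj G) (ιψ≗e i) (ιψ≗e j)) (e-adj i j)
  ) , ιψ≗e

record Homogeneous (g : Bool → Bool) (G : Graph) (m : ℕ) : Set where
  field
    vertex           : Fin m → Fin (n G)
    vertex-injective : Injective _≡_ _≡_ vertex
    related          : ∀ {i j} → i ≢ j → g (adj G (vertex i) (vertex j)) ≡ true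
open Homogeneous

Clique Independent : Graph → ℕ → Set
Clique      = Homogeneous id
Independent = Homogeneous not

HomogeneousSet : (Bool → Bool) → (G : Graph) → Subset (n G) → Set
HomogeneousSet g G P = ∀ {u v} → u ∈ P → v ∈ P → u ≢ v → g (adj G u v) ≡ true

module _ {g : Bool → Bool} where

  homogeneous-∅ : ∀ {G} → Homogeneous g G 0
  homogeneous-∅ = record { vertex = λ () ; vertex-injective = λ { {()} } ; related = λ { {()} } }

  homogeneous-≤ᵢ : ∀ {H G m} → Homogeneous g H m → H ≤ᵢ G → Homogeneous g G m
  homogeneous-≤ᵢ C (e , e-inj , e-adj) = record
    { vertex           = e ∘ vertex C
    ; vertex-injective = vertex-injective C ∘ e-inj
    ; related          = λ i≢j → ≡.trans (cong g (e-adj _ _)) (related C i≢j)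
    }

  homogeneous-∘ : ∀ {G m k} (C : Homogeneous g G m) (f : Fin k → Fin m) → Injective _≡_ _≡_ f →
    Homogeneous g G k
  homogeneous-∘ C f f-inj = record
    { vertex           = vertex C ∘ f
    ; vertex-injective = f-inj ∘ vertex-injective C
    ; related          = λ i≢j → related C (i≢j ∘ f-inj)
    }

  homogeneous-⟦⟧ : ∀ {G m} (S : Subset (n G)) (C : Homogeneous g G m) → (∀ i → vertex C i ∈ S) →
    Homogeneous g (G ⟦ S ⟧) m
  homogeneous-⟦⟧ {G} S C C⊆S with factor-ι S (vertex C) C⊆S
  ... | ψ , ιψ≗vertex = record
    { vertex           = ψ
    ; vertex-injective = factor-injective (ι S) ιψ≗vertex (vertex-injective C)
    ; related          = λ i≢j → ≡.subst (λ b → g b ≡ true)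
                           (≡.sym (cong₂ (adj G) (ιψ≗vertex _) (ιψ≗vertex _))) (related C i≢j)
    }

  extend : ∀ {G m} (C : Homogeneous g G m) (v : Fin (n G)) →
    (∀ i → vertex C i ≢ v) → (∀ i → g (adj G v (vertex C i)) ≡ true) → Homogeneous g G (suc m)
  extend {G} C v v∉C v~C =
    record { vertex = vertex′ ; vertex-injective = injective′ ; related = related′ }
    where
    vertex′ : Fin (suc _) → Fin (n G)
    vertex′ zero    = v
    vertex′ (suc i) = vertex C i
    injective′ : Injective _≡_ _≡_ vertex′
    injective′ {zero}  {zero}  _  = refl
    injective′ {zero}  {suc j} eq = ⊥-elim (v∉C j (≡.sym eq))
    injective′ {suc i} {zero}  eq = ⊥-elim (v∉C i eq)
    injective′ {suc i} {suc j} eq = cong suc (vertex-injective C eq)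
    related′ : ∀ {i j} → i ≢ j → g (adj G (vertex′ i) (vertex′ j)) ≡ true
    related′ {zero}  {zero}  i≢j = ⊥-elim (i≢j refl)
    related′ {zero}  {suc j} _   = v~C j
    related′ {suc i} {zero}  _   = ≡.trans (cong g (sym G (vertex C i) v)) (v~C i)
    related′ {suc i} {suc j} i≢j = related C (i≢j ∘ cong suc)

  homogeneous-image : ∀ {G m} (C : Homogeneous g G m) → HomogeneousSet g G (image (vertex C) ⊤)
  homogeneous-image C u∈ v∈ u≢v with ∈-image⁻ (vertex C) u∈ | ∈-image⁻ (vertex C) v∈
  ... | i , _ , refl | j , _ , refl = related C (u≢v ∘ cong (vertex C))

  ≤∣image∣ : ∀ {G m} (C : Homogeneous g G m) → m ≤ ∣ image (vertex C) ⊤ ∣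
  ≤∣image∣ C = injective⇒≤∣∣ (vertex C) (vertex-injective C) (λ i → ∈-image⁺ (vertex C) ∈⊤)

  homogeneous-members : ∀ {G m} {P : Subset (n G)} → HomogeneousSet g G P → m ≤ ∣ P ∣ →
    Homogeneous g G m
  homogeneous-members {m = m} {P} P-hom m≤∣P∣ = record
    { vertex           = vertex′
    ; vertex-injective = injective′
    ; related          = λ i≢j → P-hom (ι-∈ P _) (ι-∈ P _) (i≢j ∘ injective′)
    }
    where
    m≤length : m ≤ length (members P)
    m≤length = subst (m ≤_) (≡.sym (length-members P)) m≤∣P∣
    vertex′ : Fin m → Fin _
    vertex′ i = ι P (inject≤ i m≤length)
    injective′ : Injective _≡_ _≡_ vertex′
    injective′ = inject≤-injective m≤length m≤length _ _ ∘ ι-injective P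

clique⇒K≤ᵢ : ∀ {G m} → Clique G m → K m ≤ᵢ G
clique⇒K≤ᵢ {G} {m} C = vertex C , vertex-injective C , adj≡
  where
  adj≡ : ∀ i j → adj G (vertex C i) (vertex C j) ≡ adj (K m) i j
  adj≡ i j with i Fin.≟ j
  ... | yes refl = irrefl G (vertex C i)
  ... | no i≢j   = related C i≢j

module _ {A : Set} {p : A → Bool} where

  T-allᵇ⁺ : ∀ (xs : List A) → (∀ x → T (p x)) → T (allᵇ p xs)
  T-allᵇ⁺ []       _  = _
  T-allᵇ⁺ (x ∷ xs) Tp = Equivalence.from T-∧ (Tp x , T-allᵇ⁺ xs Tp)

  T-allᵇ⁻ : ∀ {xs : List A} → T (allᵇ p xs) → ∀ {x} → x ∈ₗ xs → T (p x)
  T-allᵇ⁻ {_ ∷ _} T-all (here refl) = proj₁ (Equivalence.to T-∧ T-all)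
  T-allᵇ⁻ {_ ∷ _} T-all (there x∈)  = T-allᵇ⁻ (proj₂ (Equivalence.to T-∧ T-all)) x∈

∈-subsets : ∀ {m} (P : Subset m) → P ∈ₗ subsets m
∈-subsets Vec.[] = here refl
∈-subsets {suc m} (inside ∷ P)  = ∈-++⁺ˡ (∈-map⁺ (inside ∷_) (∈-subsets P))
∈-subsets {suc m} (outside ∷ P) =
  ∈-++⁺ʳ (List.map (inside ∷_) (subsets m)) (∈-map⁺ (outside ∷_) (∈-subsets P))

homogeneousᵇ : (Bool → Bool) → (G : Graph) → Subset (n G) → Bool
homogeneousᵇ g G S = allᵇ (λ i → allᵇ (λ j →
    not (Vec.lookup S i ∧ Vec.lookup S j) ∨ ⌊ i Fin.≟ j ⌋ ∨ g (adj G i j))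
  (allFin (n G))) (allFin (n G))

-- ω G and α G are, by definition, maxHomogeneous id G and maxHomogeneous not G.
maxHomogeneous : (Bool → Bool) → Graph → ℕ
maxHomogeneous g G = maxℕ (List.map ∣_∣ (filterᵇ (homogeneousᵇ g G) (subsets (n G))))

module _ {g : Bool → Bool} {G : Graph} where

  homogeneousᵇ-complete : ∀ {P} → HomogeneousSet g G P → T (homogeneousᵇ g G P)
  homogeneousᵇ-complete {P} P-hom =
    T-allᵇ⁺ (allFin (n G)) λ i → T-allᵇ⁺ (allFin (n G)) λ j → pair i j
    where
    pair : ∀ i j → T (not (Vec.lookup P i ∧ Vec.lookup P j) ∨ ⌊ i Fin.≟ j ⌋ ∨ g (adj G i j))
    pair i j with Vec.lookup P i in Pi | Vec.lookup P j in Pj | i Fin.≟ j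
    ... | false | _     | _       = _
    ... | true  | false | _       = _
    ... | true  | true  | yes _   = _
    ... | true  | true  | no i≢j  =
      Equivalence.from T-≡ (P-hom (lookup⇒[]= i P Pi) (lookup⇒[]= j P Pj) i≢j)

  homogeneousᵇ-sound : ∀ {P} → T (homogeneousᵇ g G P) → HomogeneousSet g G P
  homogeneousᵇ-sound T-hom {u} {v} u∈P v∈P u≢v
    with T-allᵇ⁻ (T-allᵇ⁻ T-hom (∈-allFin u)) (∈-allFin v)
  ... | T-pair rewrite []=⇒lookup u∈P | []=⇒lookup v∈P with u Fin.≟ v
  ...   | yes u≡v = ⊥-elim (u≢v u≡v)
  ...   | no _    = Equivalence.to T-≡ T-pair

  homogeneous⇒≤max : ∀ {m} → Homogeneous g G m → m ≤ maxHomogeneous g G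
  homogeneous⇒≤max C = ≤-trans (≤∣image∣ C) (≤maxℕ (∈-map⁺ ∣_∣ image∈))
    where
    image∈ : image (vertex C) ⊤ ∈ₗ filterᵇ (homogeneousᵇ g G) (subsets (n G))
    image∈ = ∈-filter⁺ (T? ∘ homogeneousᵇ g G) (∈-subsets _)
               (homogeneousᵇ-complete (homogeneous-image C))

  <max⇒homogeneous : ∀ {k} → k < maxHomogeneous g G → Homogeneous g G (suc k)
  <max⇒homogeneous k<max with <maxℕ⇒ _ k<max
  ... | _ , x∈ , k<x with ∈-map⁻ ∣_∣ x∈
  ...   | P , P∈ , x≡∣P∣ =
    homogeneous-members {P = P} (homogeneousᵇ-sound {P} P-hom) (subst (_ <_) x≡∣P∣ k<x)
    where
    P-hom : T (homogeneousᵇ g G P)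
    P-hom = proj₂ (∈-filter⁻ (T? ∘ homogeneousᵇ g G) {xs = subsets (n G)} P∈)

maxHomogeneous-mono : ∀ {g H G} → H ≤ᵢ G → maxHomogeneous g H ≤ maxHomogeneous g G
maxHomogeneous-mono {g} {H} {G} H≤G = ≮⇒≥ λ G<H →
  1+n≰n (homogeneous⇒≤max (homogeneous-≤ᵢ {g} {H} {G} (<max⇒homogeneous G<H) H≤G))

-- Ramsey's theorem

∣tabulate∣+∣tabulate-not∣ : ∀ {m} (f : Fin m → Bool) →
  ∣ Vec.tabulate f ∣ + ∣ Vec.tabulate (not ∘ f) ∣ ≡ m
∣tabulate∣+∣tabulate-not∣ {zero}  f = refl
∣tabulate∣+∣tabulate-not∣ {suc m} f with f zero | ∣tabulate∣+∣tabulate-not∣ (f ∘ suc)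
... | true  | eq = cong suc eq
... | false | eq = ≡.trans (+-suc _ _) (cong suc eq)

ramsey : ∀ a b (G : Graph) → 2 ^ (a + b) ≤ n G → Clique G a ⊎ Independent G b
ramsey zero    _       _ _ = inj₁ homogeneous-∅
ramsey (suc _) zero    _ _ = inj₂ homogeneous-∅
ramsey (suc a) (suc b) record { n = zero } 2^≤0 = ⊥-elim (<⇒≱ (m^n>0 2 (suc a + suc b)) 2^≤0)
-- Vertex 0 splits the others into neighbours N id and non-neighbours N not; as there are
-- at least 2 · 2^(a + b + 1) − 1 others, one of the two parts has 2^(a + b + 1) vertices.
ramsey (suc a) (suc b) G@record { n = suc m } 2^≤n =
  [ (λ big-N → Sum.map (grow id) (lift id) (ramsey a (suc b) (G ⟦ N id ⟧) (fits id big-N)))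
  , (λ big-M → Sum.map (lift not) (grow not) (ramsey (suc a) b (G ⟦ N not ⟧)
                 (fits not (subst (λ e → 2 ^ e ≤ ∣ N not ∣) (+-suc a b) big-M))))
  ]′ (pigeonhole-+ (2 ^ (a + suc b)) ∣ N id ∣ ∣ N not ∣ halves)
  where
  N : (Bool → Bool) → Subset (suc m)
  N g = outside ∷ Vec.tabulate (λ u → g (adj G zero (suc u)))

  halves : 2 ^ (a + suc b) + 2 ^ (a + suc b) ≤ suc (∣ N id ∣ + ∣ N not ∣)
  halves = ≡.subst₂ _≤_ (cong (λ x → 2 ^ (a + suc b) + x) (+-identityʳ _))
             (cong suc (≡.sym (∣tabulate∣+∣tabulate-not∣ (λ u → adj G zero (suc u))))) 2^≤n

  fits : ∀ g {k} → k ≤ ∣ N g ∣ → k ≤ n (G ⟦ N g ⟧)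
  fits g = subst (_ ≤_) (≡.sym (length-members (N g)))

  N-related : ∀ g {u} → u ∈ N g → u ≢ zero × g (adj G zero u) ≡ true
  N-related g {suc u} (Vec.there u∈) =
    (λ ()) , ≡.trans (≡.sym (lookup∘tabulate _ u)) ([]=⇒lookup u∈)

  lift : ∀ g {h k} → Homogeneous h (G ⟦ N g ⟧) k → Homogeneous h G k
  lift g C = homogeneous-≤ᵢ C (⟦⟧-≤ᵢ G (N g))

  grow : ∀ g {k} → Homogeneous g (G ⟦ N g ⟧) k → Homogeneous g G (suc k)
  grow g C = extend (lift g C) zero (proj₁ ∘ N-related g ∘ ι-∈ (N g) ∘ vertex C)
                                  (proj₂ ∘ N-related g ∘ ι-∈ (N g) ∘ vertex C)

n<2^[ω+α+2] : ∀ G → n G < 2 ^ (suc (ω G) + suc (α G))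
n<2^[ω+α+2] G = ≰⇒> λ 2^≤n →
  [ (λ C → 1+n≰n (homogeneous⇒≤max C)) , (λ I → 1+n≰n (homogeneous⇒≤max I)) ]′ (ramsey _ _ G 2^≤n)

-- Modulators

αμ≤⇒μ≤ : ∀ {ρ c G k} → αμ≤ ρ c G k → μ≤ ρ c G (2 ^ (suc (ω G) + suc k))
αμ≤⇒μ≤ {G = G} {k} (S , S-mod , α≤k) = S , S-mod , <⇒≤ (begin-strict
  ∣ S ∣                                          ≡⟨ length-members S ⟨
  n (G ⟦ S ⟧)                                    <⟨ n<2^[ω+α+2] (G ⟦ S ⟧) ⟩
  2 ^ (suc (ω (G ⟦ S ⟧)) + suc (α (G ⟦ S ⟧)))  ≤⟨ ^-monoʳ-≤ 2 (+-mono-≤ (s≤s ω-mono) (s≤s α≤k)) ⟩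
  2 ^ (suc (ω G) + suc k)                        ∎)
  where
  open ≤-Reasoning
  ω-mono : ω (G ⟦ S ⟧) ≤ ω G
  ω-mono = maxHomogeneous-mono {id} {G ⟦ S ⟧} {G} (⟦⟧-≤ᵢ G S)

─-∪-≤ᵢ : ∀ G (S : Subset (n G)) (T : Subset (n (G ─ S))) →
  (G ─ (S ∪ image (ι (∁ S)) T)) ≤ᵢ ((G ─ S) ─ T)
─-∪-≤ᵢ G S T = proj₁ (≤ᵢ-restrict {G ─ (S ∪ T′)} {G ─ S} (proj₁ into-G─S) (∁ T) avoids-T)
  where
  T′ = image (ι (∁ S)) T
  avoids-S∪T′ : ∀ x → ι (∁ (S ∪ T′)) x ∉ S ∪ T′
  avoids-S∪T′ x = x∈∁p⇒x∉p (ι-∈ (∁ (S ∪ T′)) x)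
  into-G─S : Σ[ e ∈ (G ─ (S ∪ T′)) ≤ᵢ (G ─ S) ]
               (∀ x → ι (∁ S) (proj₁ e x) ≡ ι (∁ (S ∪ T′)) x)
  into-G─S = ≤ᵢ-restrict {G ─ (S ∪ T′)} {G} (⟦⟧-≤ᵢ G (∁ (S ∪ T′))) (∁ S)
               (λ x → x∉p⇒x∈∁p (avoids-S∪T′ x ∘ x∈p∪q⁺ ∘ inj₁))
  avoids-T : ∀ x → proj₁ (proj₁ into-G─S) x ∈ ∁ T
  avoids-T x = x∉p⇒x∈∁p λ x∈T → avoids-S∪T′ x
    (x∈p∪q⁺ (inj₂ (subst (_∈ T′) (proj₂ into-G─S x) (∈-image⁺ (ι (∁ S)) x∈T))))

clique-exchange : ∀ {G m} {S I : Subset (n G)} → I ⊆ S → HomogeneousSet not G I →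
  Clique (G ─ (S ∖ I)) (suc m) → Clique (G ─ S) m
clique-exchange {G} {m} {S} {I} I⊆S I-indep C =
  homogeneous-⟦⟧ (∁ S) (homogeneous-∘ C′ (punchIn i₀) (punchIn-injective i₀ _ _))
                 (x∉p⇒x∈∁p ∘ avoids-S)
  where
  C′ : Clique G (suc m)
  C′ = homogeneous-≤ᵢ C (⟦⟧-≤ᵢ G (∁ (S ∖ I)))
  χ = vertex C′
  ∈S⇒∈I : ∀ i → χ i ∈ S → χ i ∈ I
  ∈S⇒∈I i χi∈S with χ i ∈? I
  ... | yes χi∈I = χi∈I
  ... | no χi∉I  =
    ⊥-elim (x∈∁p⇒x∉p (ι-∈ (∁ (S ∖ I)) (vertex C i)) (x∈p∧x∉q⇒x∈p─q χi∈S χi∉I))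
  at-most-one : ∀ {i j} → χ i ∈ S → χ j ∈ S → i ≡ j
  at-most-one {i} {j} χi∈S χj∈S with i Fin.≟ j
  ... | yes i≡j = i≡j
  ... | no i≢j  = ⊥-elim (not-¬ (≡.sym (related C′ i≢j))
                    (≡.sym (I-indep (∈S⇒∈I i χi∈S) (∈S⇒∈I j χj∈S) (i≢j ∘ vertex-injective C′))))
  i₀ = proj₁ (unique⇒punchIn-avoids (λ i → χ i ∈? S) at-most-one)
  avoids-S : ∀ j → χ (punchIn i₀ j) ∉ S
  avoids-S = proj₂ (unique⇒punchIn-avoids (λ i → χ i ∈? S) at-most-one)

ω-exchange : ∀ {G m} {S I : Subset (n G)} → ¬ K m ≤ᵢ (G ─ S) → I ⊆ S → HomogeneousSet not G I →
  ω (G ─ (S ∖ I)) ≤ m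
ω-exchange {G} {m} {S} {I} K-free I⊆S I-indep = ≮⇒≥ λ m<ω →
  K-free (clique⇒K≤ᵢ (clique-exchange {G} {m} {S} {I} I⊆S I-indep
    (<max⇒homogeneous {id} {G ─ (S ∖ I)} m<ω)))

independent-subset : ∀ {G k} {S : Subset (n G)} → k < α (G ⟦ S ⟧) →
  ∃[ I ] I ⊆ S × HomogeneousSet not G I × k < ∣ I ∣
independent-subset {G} {k} {S} k<α =
  image (vertex I) ⊤ , image⊆S , homogeneous-image I , ≤∣image∣ I
  where
  I : Independent G (suc k)
  I = homogeneous-≤ᵢ {not} {G ⟦ S ⟧} {G} (<max⇒homogeneous {not} {G ⟦ S ⟧} k<α) (⟦⟧-≤ᵢ G S)
  image⊆S : image (vertex I) ⊤ ⊆ S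
  image⊆S v∈ = subst (_∈ S) (proj₂ (proj₂ (∈-image⁻ (vertex I) v∈))) (ι-∈ S _)

module _ (ρ : GraphParameter) (ρ-mono : ∀ H G → H ≤ᵢ G → ρ H ≤ ρ G) (c : ℤ) where

  modulator-∪ : ∀ {G} (S : Subset (n G)) T → Modulator ρ c (G ─ S) T →
    Modulator ρ c G (S ∪ image (ι (∁ S)) T)
  modulator-∪ {G} S T T-mod = ℤ.≤-trans (ℤ.+≤+ (ρ-mono _ _ (─-∪-≤ᵢ G S T))) T-mod

  modulated⇒K-free : ∀ {X m} → + ρ X ℤ.≤ c → ℤ.∣ c ∣ < ρ (K m) → ¬ K m ≤ᵢ X
  modulated⇒K-free ρX≤c ∣c∣<ρK K≤X = <⇒≱ ∣c∣<ρK (≤-trans (ρ-mono _ _ K≤X) (+≤⇒≤∣∣ ρX≤c))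

  module _ {m₀} (∣c∣<ρK : ℤ.∣ c ∣ < ρ (K m₀)) (f : ℕ → ℕ) (f-mono : ∀ a b → a ≤ b → f a ≤ f b)
           {G : Graph} (μ≤f∘ω : ∀ H → H ≤ᵢ G → μ≤ ρ c H (f (ω H))) where

    smaller-modulator : ∀ {S} → Modulator ρ c G S →
      ∃[ I ] I ⊆ S × HomogeneousSet not G I × f m₀ < ∣ I ∣ →
      ∃[ S′ ] Modulator ρ c G S′ × ∣ S′ ∣ < ∣ S ∣
    smaller-modulator {S} S-mod (I , I⊆S , I-indep , f[m₀]<∣I∣) =
      (S ∖ I) ∪ R′ , modulator-∪ {G} (S ∖ I) R R-mod , smaller
      where
      open ≤-Reasoning
      R-small : μ≤ ρ c (G ─ (S ∖ I)) (f (ω (G ─ (S ∖ I))))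
      R-small = μ≤f∘ω (G ─ (S ∖ I)) (⟦⟧-≤ᵢ G (∁ (S ∖ I)))
      R = proj₁ R-small
      R-mod = proj₁ (proj₂ R-small)
      ∣R∣≤ = proj₂ (proj₂ R-small)
      R′ = image (ι (∁ (S ∖ I))) R
      ω≤m₀ : ω (G ─ (S ∖ I)) ≤ m₀
      ω≤m₀ = ω-exchange {G} {m₀} {S} {I} (modulated⇒K-free {G ─ S} {m₀} S-mod ∣c∣<ρK) I⊆S I-indep
      smaller : ∣ (S ∖ I) ∪ R′ ∣ < ∣ S ∣
      smaller = begin-strict
        ∣ (S ∖ I) ∪ R′ ∣     ≤⟨ ∣p∪q∣≤∣p∣+∣q∣ (S ∖ I) R′ ⟩
        ∣ S ∖ I ∣ + ∣ R′ ∣   ≤⟨ +-monoʳ-≤ ∣ S ∖ I ∣ (∣image∣≤∣∣ (ι (∁ (S ∖ I))) R) ⟩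
        ∣ S ∖ I ∣ + ∣ R ∣    ≤⟨ +-monoʳ-≤ ∣ S ∖ I ∣ (≤-trans ∣R∣≤ (f-mono _ _ ω≤m₀)) ⟩
        ∣ S ∖ I ∣ + f m₀     <⟨ +-monoʳ-< ∣ S ∖ I ∣ f[m₀]<∣I∣ ⟩
        ∣ S ∖ I ∣ + ∣ I ∣    ≡⟨ ∣p∖q∣+∣q∣≡∣p∣ I⊆S ⟩
        ∣ S ∣                ∎

    hereditary-μ≤⇒αμ≤ : αμ≤ ρ c G (f m₀)
    hereditary-μ≤⇒αμ≤ = descend ∣_∣ {Modulator ρ c G} (λ S → α (G ⟦ S ⟧) ≤? f m₀)
      (λ {S} S-mod α≰ → smaller-modulator S-mod (independent-subset {G} {f m₀} {S} (≰⇒> α≰)))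
      {proj₁ initial} (proj₁ (proj₂ initial))
      where
      initial : μ≤ ρ c G (f (ω G))
      initial = μ≤f∘ω G (≤ᵢ-refl {G})

theorem5p7 : (ρ : GraphParameter) → Heavy ρ → (c : ℤ) → (𝒢 : GraphClass) →
    CliqueBounded (μ≤ ρ c) 𝒢 ⇔ Bounded (αμ≤ ρ c) 𝒢
theorem5p7 ρ (ρ-mono , ρ-unbounded) c 𝒢 = mk⇔ clique-bounded⇒bounded bounded⇒clique-bounded
  where
  clique-bounded⇒bounded : CliqueBounded (μ≤ ρ c) 𝒢 → Bounded (αμ≤ ρ c) 𝒢
  clique-bounded⇒bounded (f , f-mono , μ≤f∘ω) = f m₀ , λ G G∈𝒢 G′ G′≤G →
    hereditary-μ≤⇒αμ≤ ρ ρ-mono c ∣c∣<ρK f f-mono {G′}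
      (λ H H≤G′ → μ≤f∘ω G G∈𝒢 H (≤ᵢ-trans {H} {G′} {G} H≤G′ G′≤G))
    where
    m₀ = proj₁ (ρ-unbounded ℤ.∣ c ∣)
    ∣c∣<ρK = proj₂ (ρ-unbounded ℤ.∣ c ∣)
  bounded⇒clique-bounded : Bounded (αμ≤ ρ c) 𝒢 → CliqueBounded (μ≤ ρ c) 𝒢
  bounded⇒clique-bounded (k , αμ≤k) =
    (λ w → 2 ^ (suc w + suc k)) ,
    (λ a b a≤b → ^-monoʳ-≤ 2 (+-monoˡ-≤ (suc k) (s≤s a≤b))) ,
    λ G G∈𝒢 G′ G′≤G → αμ≤⇒μ≤ {ρ} {c} {G′} {k} (αμ≤k G G∈𝒢 G′ G′≤G)
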